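{- Let $\Gamma$ be a finite connected graph with at least $3$ vertices. Suppose $v_1,v_2$ are two vertices of $\Gamma$, each of degree $d$, such that the set $\{v_1,v_2\}$ has the conformity property. Let $e_{12}$ be the class of $v_1-v_2$ in $\operatorname{Pic}^0(\Gamma)$. Then if $v_1v_2$ is an edge, $e_{12}$ has order $d+1$, and otherwise $e_{12}$ has order $d$.
   Context: A subset $S=\{w_1,\dots,w_m\}\subset V(\Gamma)$ has the conformity property if the induced subgraph on $S$ is either completely disconnected or complete, and for every vertex $x\notin S$ and all $i,j$, $w_ix$ is an edge if and only if $w_jx$ is an edge. $\operatorname{Div}(\Gamma)$ is the free abelian group on $V(\Gamma)$, $\operatorname{Div}^0(\Gamma)$ is the kernel of the degree map $\sum a_v v\mapsto\sum a_v$, the Laplacian $\Delta(\Gamma):\operatorname{Div}(\Gamma)\to\operatorname{Div}^0(\Gamma)$ is given by $v\mapsto(\deg v)\,v-\sum_{wv\in E(\Gamma)}w$, and $\operatorname{Pic}^0(\Gamma)=\operatorname{Div}^0(\Gamma)/\operatorname{im}\Delta(\Gamma)$. -}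

module Defs where

open import Data.Nat as ℕ using (ℕ; zero; suc; _<_)
open import Data.Integer as ℤ using (ℤ; +_; _-_; _*_)
open import Data.Fin using (Fin)
import Data.Fin as F
open import Data.Fin.Properties using (_≟_)
open import Data.Bool using (Bool; true; false; if_then_else_; _∨_)
open import Data.Product using (Σ; ∃; _×_)
open import Data.Sum using (_⊎_)
open import Relation.Nullary using (¬_)
open import Relation.Nullary.Decidable using (⌊_⌋)
open import Relation.Binary.PropositionalEquality using (_≡_; _≢_)

record Graph (n : ℕ) : Set where
  field
    adj     : Fin n → Fin n → Bool
    symm    : ∀ u v → adj u v ≡ adj v u
    irrefl  : ∀ v → adj v v ≡ false
open Graph public

Σℕ : ∀ {n} → (Fin n → ℕ) → ℕ
Σℕ {zero}  f = 0
Σℕ {suc n} f = f F.zero ℕ.+ Σℕ (λ i → f (F.suc i))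

Σℤ : ∀ {n} → (Fin n → ℤ) → ℤ
Σℤ {zero}  f = + 0
Σℤ {suc n} f = f F.zero ℤ.+ Σℤ (λ i → f (F.suc i))

deg : ∀ {n} → Graph n → Fin n → ℕ
deg G v = Σℕ (λ w → if adj G v w then 1 else 0)

data Reach {n} (G : Graph n) : Fin n → Fin n → Set where
  here : ∀ {u} → Reach G u u
  step : ∀ {u w v} → adj G u w ≡ true → Reach G w v → Reach G u v

Connected : ∀ {n} → Graph n → Set
Connected G = ∀ u v → Reach G u v

-- Divisors: Div(Γ) = free abelian group on V(Γ), represented by coefficient functions.
Div : ℕ → Set
Div n = Fin n → ℤ

-- Laplacian: v ↦ (deg v) v − Σ_{w ~ v} w, extended linearly; coefficient at v of Δ(f).
Δ : ∀ {n} → Graph n → Div n → Div n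
Δ G f v = (+ deg G v) * f v - Σℤ (λ w → if adj G v w then f w else + 0)

-- D lies in im Δ (i.e. the class of D in Pic⁰ is trivial)
Principal : ∀ {n} → Graph n → Div n → Set
Principal G D = ∃ λ f → ∀ v → D v ≡ Δ G f v

_·_ : ∀ {n} → ℕ → Div n → Div n
(k · D) v = + k * D v

HasOrder : ∀ {n} → Graph n → Div n → ℕ → Set
HasOrder G D k =
  0 < k × Principal G (k · D) × (∀ j → 0 < j → j < k → ¬ Principal G (j · D))

diff : ∀ {n} → Fin n → Fin n → Div n
diff v₁ v₂ v = (if ⌊ v ≟ v₁ ⌋ then + 1 else + 0) - (if ⌊ v ≟ v₂ ⌋ then + 1 else + 0)

Conformity : ∀ {n} → Graph n → (Fin n → Bool) → Set
Conformity G S =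
  ( (∀ i j → S i ≡ true → S j ≡ true → adj G i j ≡ false)
  ⊎ (∀ i j → S i ≡ true → S j ≡ true → i ≢ j → adj G i j ≡ true) )
  × (∀ x i j → S x ≡ false → S i ≡ true → S j ≡ true → adj G i x ≡ adj G j x)

pair : ∀ {n} → Fin n → Fin n → Fin n → Bool
pair v₁ v₂ x = ⌊ x ≟ v₁ ⌋ ∨ ⌊ x ≟ v₂ ⌋

module Submission where

-- If Δ f = j · D then f + f ∘ σ is harmonic, hence constant;
--    evaluating at a third vertex x₀ (fixed by σ) shows f = f x₀ + t · D, so j = t · κ,
--    which rules out 0 < j < κ.
-- 6. Connectedness makes d positive, and the theorem follows by taking κ = d + 1 or κ = d.

open import Defs
open import Data.Nat as ℕ using (ℕ; _≤_; _<_; suc; zero; s≤s; z≤n)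
open import Data.Nat.Divisibility using (divides; ∣⇒≤)
import Data.Nat.Properties as ℕP
open import Data.Integer as ℤ using (ℤ; +_; -_; _-_; _*_; _+_; +≤+) renaming (_≤_ to _≤ℤ_)
import Data.Integer.Properties as ℤP
open import Data.Integer.Solver using (module +-*-Solver)
open import Data.Fin using (Fin; zero; suc; punchIn)
open import Data.Fin.Properties using (_≟_; punchInᵢ≢i)
open import Data.Fin.Permutation using (Permutation; _⟨$⟩ʳ_; transpose)
open import Data.Bool using (Bool; true; false; if_then_else_)
open import Data.Product using (_×_; _,_; ∃; proj₁; proj₂)
open import Data.Sum using (_⊎_; inj₁; inj₂)
open import Data.Empty using (⊥-elim)
open import Function using (_∘_)
open import Relation.Nullary using (¬_; yes; no)
open import Relation.Nullary.Decidable using (⌊_⌋; isYes≗does; dec-true; dec-false)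
open import Relation.Binary.PropositionalEquality
open import Algebra.Properties.Semiring.Sum ℤP.+-*-semiring
  using (sum; sum-cong-≗; sum-remove; sum-replicate-zero; ∑-distrib-+; *-distribˡ-sum; sum-permute)

open +-*-Solver

Σℤ≡sum : ∀ {n} (f : Fin n → ℤ) → Σℤ f ≡ sum f
Σℤ≡sum {zero}  f = refl
Σℤ≡sum {suc n} f = cong (_+_ (f zero)) (Σℤ≡sum (f ∘ suc))

Σℤ-cong : ∀ {n} {f g : Fin n → ℤ} → (∀ i → f i ≡ g i) → Σℤ f ≡ Σℤ g
Σℤ-cong {f = f} {g} f≗g = trans (Σℤ≡sum f) (trans (sum-cong-≗ f≗g) (sym (Σℤ≡sum g)))

Σℤ-+ : ∀ {n} (f g : Fin n → ℤ) → Σℤ (λ i → f i + g i) ≡ Σℤ f + Σℤ g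
Σℤ-+ f g = trans (Σℤ≡sum (λ i → f i + g i))
  (trans (∑-distrib-+ f g) (sym (cong₂ _+_ (Σℤ≡sum f) (Σℤ≡sum g))))

Σℤ-* : ∀ {n} (c : ℤ) (f : Fin n → ℤ) → Σℤ (λ i → c * f i) ≡ c * Σℤ f
Σℤ-* c f = trans (Σℤ≡sum (λ i → c * f i))
  (trans (sym (*-distribˡ-sum c f)) (cong (c *_) (sym (Σℤ≡sum f))))

Σℤ-- : ∀ {n} (f g : Fin n → ℤ) → Σℤ (λ i → f i - g i) ≡ Σℤ f - Σℤ g
Σℤ-- f g = begin
  Σℤ (λ i → f i - g i)              ≡⟨ Σℤ-cong (λ i → cong (_+_ (f i)) (sym (ℤP.-1*i≡-i (g i)))) ⟩
  Σℤ (λ i → f i + ℤ.-1ℤ * g i)      ≡⟨ Σℤ-+ f (λ i → ℤ.-1ℤ * g i) ⟩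
  Σℤ f + Σℤ (λ i → ℤ.-1ℤ * g i)     ≡⟨ cong (_+_ (Σℤ f))
                                         (trans (Σℤ-* ℤ.-1ℤ g) (ℤP.-1*i≡-i (Σℤ g))) ⟩
  Σℤ f - Σℤ g                       ∎
  where open ≡-Reasoning

Σℤ-permute : ∀ {n} (f : Fin n → ℤ) (π : Permutation n n) → Σℤ (λ i → f (π ⟨$⟩ʳ i)) ≡ Σℤ f
Σℤ-permute f π = trans (Σℤ≡sum (λ i → f (π ⟨$⟩ʳ i))) (trans (sym (sum-permute f π)) (sym (Σℤ≡sum f)))

Σℤ-single : ∀ {n} (f : Fin n → ℤ) (u : Fin n) → (∀ w → w ≢ u → f w ≡ + 0) → Σℤ f ≡ f u
Σℤ-single {suc n} f u off-u = begin
  Σℤ f                                ≡⟨ Σℤ≡sum f ⟩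
  sum f                               ≡⟨ sum-remove {i = u} f ⟩
  f u + sum (λ i → f (punchIn u i))   ≡⟨ cong (_+_ (f u)) (sum-cong-≗ (λ i → off-u _ (punchInᵢ≢i u i))) ⟩
  f u + sum {n} (λ _ → + 0)           ≡⟨ cong (_+_ (f u)) (sum-replicate-zero n) ⟩
  f u + + 0                           ≡⟨ ℤP.+-identityʳ (f u) ⟩
  f u                                 ∎
  where open ≡-Reasoning

Σℤ-nonneg : ∀ {n} (g : Fin n → ℤ) → (∀ w → + 0 ≤ℤ g w) → + 0 ≤ℤ Σℤ g
Σℤ-nonneg {zero}  g g≥0 = +≤+ z≤n
Σℤ-nonneg {suc n} g g≥0 = ℤP.+-mono-≤ (g≥0 zero) (Σℤ-nonneg (g ∘ suc) (g≥0 ∘ suc))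

term≤Σℤ : ∀ {n} (g : Fin n → ℤ) → (∀ w → + 0 ≤ℤ g w) → ∀ w → g w ≤ℤ Σℤ g
term≤Σℤ g g≥0 zero = ℤP.i≤i+j (g zero) (Σℤ (g ∘ suc))
  {{ℤ.nonNegative (Σℤ-nonneg (g ∘ suc) (g≥0 ∘ suc))}}
term≤Σℤ g g≥0 (suc w) = ℤP.≤-trans (term≤Σℤ (g ∘ suc) (g≥0 ∘ suc) w)
  (ℤP.i≤j+i (Σℤ (g ∘ suc)) (g zero) {{ℤ.nonNegative (g≥0 zero)}})

Σℤ-nonneg-zero : ∀ {n} (g : Fin n → ℤ) → (∀ w → + 0 ≤ℤ g w) → Σℤ g ≡ + 0 → ∀ w → g w ≡ + 0
Σℤ-nonneg-zero g g≥0 Σg≡0 w =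
  ℤP.≤-antisym (subst (g w ≤ℤ_) Σg≡0 (term≤Σℤ g g≥0 w)) (g≥0 w)

≟-self : ∀ {n} (x : Fin n) → ⌊ x ≟ x ⌋ ≡ true
≟-self x = trans (isYes≗does (x ≟ x)) (dec-true (x ≟ x) refl)

≟-distinct : ∀ {n} {x y : Fin n} → x ≢ y → ⌊ x ≟ y ⌋ ≡ false
≟-distinct {x = x} {y} x≢y = trans (isYes≗does (x ≟ y)) (dec-false (x ≟ y) x≢y)

ι : Bool → ℤ
ι b = if b then + 1 else + 0

Σℕ-as-Σℤ : ∀ {n} (f : Fin n → ℕ) → + Σℕ f ≡ Σℤ (λ i → + f i)
Σℕ-as-Σℤ {zero}  f = refl
Σℕ-as-Σℤ {suc n} f = cong (_+_ (+ f zero)) (Σℕ-as-Σℤ (f ∘ suc))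

module Laplacian {n} (G : Graph n) where

  onNbrs : Div n → Fin n → Fin n → ℤ
  onNbrs f v w = if adj G v w then f w else + 0

  nbr : Div n → Fin n → ℤ
  nbr f v = Σℤ (onNbrs f v)

  deg-as-Σℤ : ∀ v → + deg G v ≡ Σℤ (λ w → ι (adj G v w))
  deg-as-Σℤ v = trans (Σℕ-as-Σℤ (λ w → if adj G v w then 1 else 0)) (Σℤ-cong (λ w → lift (adj G v w)))
    where
    lift : ∀ b → + (if b then 1 else 0) ≡ ι b
    lift true  = refl
    lift false = refl

  deg-pos : ∀ v w → adj G v w ≡ true → 0 < deg G v
  deg-pos v w v~w = ℤP.drop‿+≤+ (begin
    + 1                              ≡⟨ cong ι v~w ⟨
    ι (adj G v w)                    ≤⟨ term≤Σℤ (ι ∘ adj G v) (λ u → ι≥0 (adj G v u)) w ⟩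
    Σℤ (λ u → ι (adj G v u))         ≡⟨ deg-as-Σℤ v ⟨
    + deg G v                        ∎)
    where
    open ℤP.≤-Reasoning
    ι≥0 : ∀ b → + 0 ≤ℤ ι b
    ι≥0 true  = +≤+ z≤n
    ι≥0 false = +≤+ z≤n

  nbr-const : ∀ c v → nbr (λ _ → c) v ≡ + deg G v * c
  nbr-const c v = begin
    nbr (λ _ → c) v                  ≡⟨ Σℤ-cong (λ w → when-const (adj G v w)) ⟩
    Σℤ (λ w → c * ι (adj G v w))     ≡⟨ Σℤ-* c (ι ∘ adj G v) ⟩
    c * Σℤ (λ w → ι (adj G v w))     ≡⟨ cong (c *_) (deg-as-Σℤ v) ⟨
    c * + deg G v                    ≡⟨ ℤP.*-comm c (+ deg G v) ⟩
    + deg G v * c                    ∎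
    where
    open ≡-Reasoning
    when-const : ∀ b → (if b then c else + 0) ≡ c * ι b
    when-const true  = sym (ℤP.*-identityʳ c)
    when-const false = sym (ℤP.*-zeroʳ c)

  nbr-+ : ∀ f g v → nbr (λ x → f x + g x) v ≡ nbr f v + nbr g v
  nbr-+ f g v = trans (Σℤ-cong (λ w → when-+ (adj G v w) (f w) (g w))) (Σℤ-+ (onNbrs f v) (onNbrs g v))
    where
    when-+ : ∀ b x y → (if b then x + y else + 0) ≡ (if b then x else + 0) + (if b then y else + 0)
    when-+ true  x y = refl
    when-+ false x y = refl

  nbr-- : ∀ f g v → nbr (λ x → f x - g x) v ≡ nbr f v - nbr g v
  nbr-- f g v = trans (Σℤ-cong (λ w → when-- (adj G v w) (f w) (g w))) (Σℤ-- (onNbrs f v) (onNbrs g v))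
    where
    when-- : ∀ b x y → (if b then x - y else + 0) ≡ (if b then x else + 0) - (if b then y else + 0)
    when-- true  x y = refl
    when-- false x y = refl

  nbr-* : ∀ t f v → nbr (λ x → t * f x) v ≡ t * nbr f v
  nbr-* t f v = trans (Σℤ-cong (λ w → when-* (adj G v w) (f w))) (Σℤ-* t (onNbrs f v))
    where
    when-* : ∀ b x → (if b then t * x else + 0) ≡ t * (if b then x else + 0)
    when-* true  x = refl
    when-* false x = sym (ℤP.*-zeroʳ t)

  Δ-cong : ∀ {f g : Div n} → (∀ v → f v ≡ g v) → ∀ u → Δ G f u ≡ Δ G g u
  Δ-cong f≗g u = cong₂ (λ x y → + deg G u * x - y) (f≗g u)
    (Σℤ-cong (λ w → cong (λ x → if adj G u w then x else + 0) (f≗g w)))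

  Δ-+ : ∀ f g u → Δ G (λ v → f v + g v) u ≡ Δ G f u + Δ G g u
  Δ-+ f g u = begin
    k * (f u + g u) - nbr (λ v → f v + g v) u
      ≡⟨ cong (λ s → k * (f u + g u) - s) (nbr-+ f g u) ⟩
    k * (f u + g u) - (nbr f u + nbr g u)
      ≡⟨ solve 5 (λ K a b S T → K :* (a :+ b) :- (S :+ T) := (K :* a :- S) :+ (K :* b :- T))
           refl k (f u) (g u) (nbr f u) (nbr g u) ⟩
    Δ G f u + Δ G g u
      ∎
    where
    open ≡-Reasoning
    k : ℤ
    k = + deg G u

  Δ-affine : ∀ (a t : ℤ) (g : Div n) u → Δ G (λ v → a + t * g v) u ≡ t * Δ G g u
  Δ-affine a t g u = begin
    k * (a + t * g u) - nbr (λ v → a + t * g v) u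
      ≡⟨ cong (λ s → k * (a + t * g u) - s) nbr-affine ⟩
    k * (a + t * g u) - (k * a + t * nbr g u)
      ≡⟨ solve 5 (λ K a t x S → K :* (a :+ t :* x) :- (K :* a :+ t :* S) := t :* (K :* x :- S))
           refl k a t (g u) (nbr g u) ⟩
    t * Δ G g u
      ∎
    where
    open ≡-Reasoning
    k : ℤ
    k = + deg G u
    nbr-affine : nbr (λ v → a + t * g v) u ≡ k * a + t * nbr g u
    nbr-affine = trans (nbr-+ (λ _ → a) (λ v → t * g v) u) (cong₂ _+_ (nbr-const a u) (nbr-* t g u))

  nbr-point : ∀ v u → nbr (λ w → if ⌊ w ≟ u ⌋ then + 1 else + 0) v ≡ ι (adj G v u)
  nbr-point v u = trans (Σℤ-single _ u off-u) at-u
    where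
    off-u : ∀ w → w ≢ u → (if adj G v w then (if ⌊ w ≟ u ⌋ then + 1 else + 0) else + 0) ≡ + 0
    off-u w w≢u rewrite ≟-distinct w≢u with adj G v w
    ... | true  = refl
    ... | false = refl
    at-u : (if adj G v u then (if ⌊ u ≟ u ⌋ then + 1 else + 0) else + 0) ≡ ι (adj G v u)
    at-u rewrite ≟-self u = refl

  Δ-as-differences : ∀ h u → Δ G h u ≡ Σℤ (λ w → if adj G u w then h u - h w else + 0)
  Δ-as-differences h u = sym (begin
    nbr (λ w → h u - h w) u                ≡⟨ nbr-- (λ _ → h u) h u ⟩
    nbr (λ _ → h u) u - nbr h u            ≡⟨ cong (_- nbr h u) (nbr-const (h u) u) ⟩
    + deg G u * h u - nbr h u              ∎)
    where open ≡-Reasoning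

Harmonic : ∀ {n} → Graph n → Div n → Set
Harmonic G h = ∀ v → Δ G h v ≡ + 0

maximum : ∀ {n} (h : Fin n → ℤ) → Fin n → ∃ λ u → ∀ w → h w ≤ℤ h u
maximum {suc zero}    h _ = zero , λ { zero → ℤP.≤-refl }
maximum {suc (suc n)} h _ with maximum (h ∘ suc) zero
... | u , h≤hu with ℤP.≤-total (h zero) (h (suc u))
...   | inj₁ h₀≤hu = suc u , λ { zero → h₀≤hu ; (suc w) → h≤hu w }
...   | inj₂ hu≤h₀ = zero , λ { zero → ℤP.≤-refl ; (suc w) → ℤP.≤-trans (h≤hu w) hu≤h₀ }

module MaximumPrinciple {n} (G : Graph n) where
  open Laplacian G

  -- At a maximum of a harmonic function, every neighbour attains the maximal value:
  -- Δ h u = Σ_{w~u} (h u − h w) is a vanishing sum of nonnegative terms.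
  max-spreads : ∀ h → Harmonic G h → ∀ u → (∀ w → h w ≤ℤ h u) →
                ∀ w → adj G u w ≡ true → h w ≡ h u
  max-spreads h harm u h≤hu w u~w =
    sym (ℤP.i-j≡0⇒i≡j (h u) (h w) (subst (λ b → (if b then h u - h w else + 0) ≡ + 0) u~w term-w≡0))
    where
    term : Fin n → ℤ
    term x = if adj G u x then h u - h x else + 0
    term≥0 : ∀ x → + 0 ≤ℤ term x
    term≥0 x with adj G u x
    ... | true  = ℤP.i≤j⇒0≤j-i (h≤hu x)
    ... | false = ℤP.≤-refl
    term-w≡0 : term w ≡ + 0
    term-w≡0 = Σℤ-nonneg-zero term term≥0 (trans (sym (Δ-as-differences h u)) (harm u)) w

  harmonic-constant : Connected G → ∀ h → Harmonic G h → ∀ v v' → h v ≡ h v'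
  harmonic-constant conn h harm v v' =
    trans (spread u refl (conn u v)) (sym (spread u refl (conn u v')))
    where
    u : Fin n
    u = proj₁ (maximum h v)
    h≤hu : ∀ w → h w ≤ℤ h u
    h≤hu = proj₂ (maximum h v)
    spread : ∀ x {y} → h x ≡ h u → Reach G x y → h y ≡ h u
    spread x hx≡hu here = hx≡hu
    spread x hx≡hu (step {w = w} x~w walk) =
      spread w (trans (max-spreads h harm x (λ z → subst (h z ≤ℤ_) (sym hx≡hu) (h≤hu z)) w x~w) hx≡hu) walk

Automorphism : ∀ {n} → Graph n → Permutation n n → Set
Automorphism G π = ∀ a b → adj G (π ⟨$⟩ʳ a) (π ⟨$⟩ʳ b) ≡ adj G a b

module Automorphisms {n} (G : Graph n) (π : Permutation n n) (auto : Automorphism G π) where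
  open Laplacian G

  Σ-neighbours-π : ∀ (g : Fin n → ℤ) v →
    Σℤ (λ w → if adj G v w then g (π ⟨$⟩ʳ w) else + 0) ≡ nbr g (π ⟨$⟩ʳ v)
  Σ-neighbours-π g v = trans
    (Σℤ-cong (λ w → cong (λ b → if b then g (π ⟨$⟩ʳ w) else + 0) (sym (auto v w))))
    (Σℤ-permute (λ w → if adj G (π ⟨$⟩ʳ v) w then g w else + 0) π)

  deg-π : ∀ v → deg G (π ⟨$⟩ʳ v) ≡ deg G v
  deg-π v = ℤP.+-injective (begin
    + deg G (π ⟨$⟩ʳ v)                                      ≡⟨ deg-as-Σℤ (π ⟨$⟩ʳ v) ⟩
    Σℤ (λ w → ι (adj G (π ⟨$⟩ʳ v) w))                       ≡⟨ Σ-neighbours-π (λ _ → + 1) v ⟨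
    Σℤ (λ w → if adj G v w then + 1 else + 0)               ≡⟨ deg-as-Σℤ v ⟨
    + deg G v                                               ∎)
    where open ≡-Reasoning

  Δ-π : ∀ (f : Div n) v → Δ G (λ w → f (π ⟨$⟩ʳ w)) v ≡ Δ G f (π ⟨$⟩ʳ v)
  Δ-π f v = cong₂ (λ k s → + k * f (π ⟨$⟩ʳ v) - s) (sym (deg-π v)) (Σ-neighbours-π f v)

x+x-injective : ∀ x y → x + x ≡ y + y → x ≡ y
x+x-injective x y x+x≡y+y = ℤP.*-cancelˡ-≡ (+ 2) x y (begin
  + 2 * x   ≡⟨ solve 1 (λ x → con (+ 2) :* x := x :+ x) refl x ⟩
  x + x     ≡⟨ x+x≡y+y ⟩
  y + y     ≡⟨ solve 1 (λ y → y :+ y := con (+ 2) :* y) refl y ⟩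
  + 2 * y   ∎)
  where open ≡-Reasoning

third-element : ∀ {n} → 3 ≤ n → (a b : Fin n) → ∃ λ x → x ≢ a × x ≢ b
third-element (s≤s (s≤s (s≤s _))) a b with zero ≟ a | zero ≟ b
... | no 0≢a | no 0≢b = zero , 0≢a , 0≢b
... | yes refl | _ with suc zero ≟ b
...   | no 1≢b   = suc zero , (λ ()) , 1≢b
...   | yes refl = suc (suc zero) , (λ ()) , (λ ())
third-element (s≤s (s≤s (s≤s _))) a b | no _ | yes refl with suc zero ≟ a
...   | no 1≢a   = suc zero , 1≢a , (λ ())
...   | yes refl = suc (suc zero) , (λ ()) , (λ ())

module Twins {n} (G : Graph n) (v₁ v₂ : Fin n) (v₁≢v₂ : v₁ ≢ v₂)
  (twin : ∀ x → x ≢ v₁ → x ≢ v₂ → adj G v₁ x ≡ adj G v₂ x)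
  (d : ℕ) (deg₁ : deg G v₁ ≡ d) (deg₂ : deg G v₂ ≡ d) where
  open Laplacian G
  open MaximumPrinciple G

  D : Div n
  D = diff v₁ v₂

  -- The claimed order of the class of D.
  κ : ℤ
  κ = + d + ι (adj G v₁ v₂)

  Outside : Fin n → Set
  Outside x = x ≢ v₁ × x ≢ v₂

  classify : ∀ x → x ≡ v₁ ⊎ x ≡ v₂ ⊎ Outside x
  classify x with x ≟ v₁ | x ≟ v₂
  ... | yes x≡v₁ | _        = inj₁ x≡v₁
  ... | no _     | yes x≡v₂ = inj₂ (inj₁ x≡v₂)
  ... | no x≢v₁  | no x≢v₂  = inj₂ (inj₂ (x≢v₁ , x≢v₂))

  D-v₁ : D v₁ ≡ + 1
  D-v₁ rewrite ≟-self v₁ | ≟-distinct v₁≢v₂ = refl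

  D-v₂ : D v₂ ≡ - + 1
  D-v₂ rewrite ≟-self v₂ | ≟-distinct (v₁≢v₂ ∘ sym) = refl

  D-outside : ∀ {x} → Outside x → D x ≡ + 0
  D-outside (x≢v₁ , x≢v₂) rewrite ≟-distinct x≢v₁ | ≟-distinct x≢v₂ = refl

  σ : Permutation n n
  σ = transpose v₁ v₂

  σ-v₁ : σ ⟨$⟩ʳ v₁ ≡ v₂
  σ-v₁ rewrite dec-true (v₁ ≟ v₁) refl = refl

  σ-v₂ : σ ⟨$⟩ʳ v₂ ≡ v₁
  σ-v₂ rewrite dec-false (v₂ ≟ v₁) (v₁≢v₂ ∘ sym) | dec-true (v₂ ≟ v₂) refl = refl

  σ-outside : ∀ {x} → Outside x → σ ⟨$⟩ʳ x ≡ x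
  σ-outside (x≢v₁ , x≢v₂) rewrite dec-false (_ ≟ v₁) x≢v₁ | dec-false (_ ≟ v₂) x≢v₂ = refl

  σ-adj-outside : ∀ a {x} → Outside x → adj G (σ ⟨$⟩ʳ a) x ≡ adj G a x
  σ-adj-outside a {x} (x≢v₁ , x≢v₂) with classify a
  ... | inj₁ refl          = trans (cong (λ y → adj G y x) σ-v₁) (sym (twin x x≢v₁ x≢v₂))
  ... | inj₂ (inj₁ refl)   = trans (cong (λ y → adj G y x) σ-v₂) (twin x x≢v₁ x≢v₂)
  ... | inj₂ (inj₂ a-out)  = cong (λ y → adj G y x) (σ-outside a-out)

  σ-automorphism : Automorphism G σ
  σ-automorphism a b with classify a | classify b
  ... | _ | inj₂ (inj₂ b-out) rewrite σ-outside b-out = σ-adj-outside a b-out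
  ... | inj₂ (inj₂ a-out) | _ rewrite σ-outside a-out =
    trans (symm G a _) (trans (σ-adj-outside b a-out) (symm G b a))
  ... | inj₁ refl        | inj₁ refl        = trans (irrefl G _) (sym (irrefl G v₁))
  ... | inj₂ (inj₁ refl) | inj₂ (inj₁ refl) = trans (irrefl G _) (sym (irrefl G v₂))
  ... | inj₁ refl        | inj₂ (inj₁ refl) rewrite σ-v₁ | σ-v₂ = symm G v₂ v₁
  ... | inj₂ (inj₁ refl) | inj₁ refl        rewrite σ-v₁ | σ-v₂ = symm G v₁ v₂

  open Automorphisms G σ σ-automorphism using (Δ-π)

  D-σ : ∀ x → D (σ ⟨$⟩ʳ x) ≡ - D x
  D-σ x with classify x
  ... | inj₁ refl         = trans (cong D σ-v₁) (trans D-v₂ (cong -_ (sym D-v₁)))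
  ... | inj₂ (inj₁ refl)  = trans (cong D σ-v₂) (trans D-v₁ (cong -_ (sym D-v₂)))
  ... | inj₂ (inj₂ x-out) =
    trans (cong D (σ-outside x-out)) (trans (D-outside x-out) (cong -_ (sym (D-outside x-out))))

  nbr-D : ∀ v → nbr D v ≡ ι (adj G v v₁) - ι (adj G v v₂)
  nbr-D v = trans (nbr-- _ _ v) (cong₂ _-_ (nbr-point v v₁) (nbr-point v v₂))

  Δ-D : ∀ v → Δ G D v ≡ κ * D v
  Δ-D v with classify v
  ... | inj₁ refl rewrite nbr-D v₁ | deg₁ | irrefl G v₁ | D-v₁ =
    solve 2 (λ d a → d :* con (+ 1) :- (con (+ 0) :- a) := (d :+ a) :* con (+ 1)) refl (+ d) (ι (adj G v₁ v₂))
  ... | inj₂ (inj₁ refl) rewrite nbr-D v₂ | deg₂ | irrefl G v₂ | symm G v₂ v₁ | D-v₂ =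
    solve 2 (λ d a → d :* con (- + 1) :- (a :- con (+ 0)) := (d :+ a) :* con (- + 1)) refl (+ d) (ι (adj G v₁ v₂))
  ... | inj₂ (inj₂ (v≢v₁ , v≢v₂))
    rewrite nbr-D v | symm G v v₁ | symm G v v₂ | twin v v≢v₁ v≢v₂ | D-outside (v≢v₁ , v≢v₂) =
    solve 3 (λ k a c → k :* con (+ 0) :- (a :- a) := c :* con (+ 0)) refl (+ deg G v) (ι (adj G v₂ v)) κ

  κD-principal : ∀ k → κ ≡ + k → Principal G (k · D)
  κD-principal k κ≡k = D , λ v → trans (cong (_* D v) (sym κ≡k)) (sym (Δ-D v))

  -- If Δ f = j·D, the symmetrisation f + f ∘ σ is harmonic, since D ∘ σ = −D.
  symmetrisation-harmonic : ∀ j f → (∀ v → (j · D) v ≡ Δ G f v) →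
                            Harmonic G (λ x → f x + f (σ ⟨$⟩ʳ x))
  symmetrisation-harmonic j f Δf≡jD v = begin
    Δ G (λ x → f x + f (σ ⟨$⟩ʳ x)) v      ≡⟨ Δ-+ f (λ x → f (σ ⟨$⟩ʳ x)) v ⟩
    Δ G f v + Δ G (λ x → f (σ ⟨$⟩ʳ x)) v  ≡⟨ cong (_+_ (Δ G f v)) (Δ-π f v) ⟩
    Δ G f v + Δ G f (σ ⟨$⟩ʳ v)            ≡⟨ cong₂ _+_ (Δf≡jD v) (Δf≡jD (σ ⟨$⟩ʳ v)) ⟨
    + j * D v + + j * D (σ ⟨$⟩ʳ v)        ≡⟨ cong (λ y → + j * D v + + j * y) (D-σ v) ⟩
    + j * D v + + j * - D v               ≡⟨ solve 2 (λ j x → j :* x :+ j :* (:- x) := con (+ 0)) refl (+ j) (D v) ⟩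
    + 0                                   ∎
    where open ≡-Reasoning

  affine-in-D : ∀ (f : Div n) x₀ → Outside x₀ →
                (∀ x → f x + f (σ ⟨$⟩ʳ x) ≡ f x₀ + f (σ ⟨$⟩ʳ x₀)) →
                ∀ v → f v ≡ f x₀ + (f v₁ - f x₀) * D v
  affine-in-D f x₀ x₀-out sym-const v with classify v
  ... | inj₁ refl rewrite D-v₁ =
    solve 2 (λ f₁ a → f₁ := a :+ (f₁ :- a) :* con (+ 1)) refl (f v₁) (f x₀)
  ... | inj₂ (inj₁ refl) rewrite D-v₂ = begin
    f v₂                         ≡⟨ solve 2 (λ f₁ f₂ → f₂ := (f₁ :+ f₂) :- f₁) refl (f v₁) (f v₂) ⟩
    (f v₁ + f v₂) - f v₁         ≡⟨ cong (_- f v₁) pair-sum ⟩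
    (f x₀ + f x₀) - f v₁         ≡⟨ solve 2 (λ f₁ a → (a :+ a) :- f₁ := a :+ (f₁ :- a) :* con (- + 1))
                                      refl (f v₁) (f x₀) ⟩
    f x₀ + (f v₁ - f x₀) * - + 1 ∎
    where
    open ≡-Reasoning
    pair-sum : f v₁ + f v₂ ≡ f x₀ + f x₀
    pair-sum = subst₂ (λ y z → f v₁ + f y ≡ f x₀ + f z) σ-v₁ (σ-outside x₀-out) (sym-const v₁)
  ... | inj₂ (inj₂ v-out) rewrite D-outside v-out = trans
    (x+x-injective (f v) (f x₀) double)
    (solve 2 (λ a t → a := a :+ t :* con (+ 0)) refl (f x₀) (f v₁ - f x₀))
    where
    double : f v + f v ≡ f x₀ + f x₀
    double = subst₂ (λ y z → f v + f y ≡ f x₀ + f z) (σ-outside v-out) (σ-outside x₀-out) (sym-const v)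

  principal⇒multiple : Connected G → 3 ≤ n → ∀ j → Principal G (j · D) → ∃ λ t → + j ≡ t * κ
  principal⇒multiple conn 3≤n j (f , Δf≡jD) = t , (begin
    + j                            ≡⟨ solve 1 (λ j → j := j :* con (+ 1)) refl (+ j) ⟩
    + j * + 1                      ≡⟨ cong (+ j *_) D-v₁ ⟨
    + j * D v₁                     ≡⟨ Δf≡jD v₁ ⟩
    Δ G f v₁                       ≡⟨ Δ-cong f-affine v₁ ⟩
    Δ G (λ v → f x₀ + t * D v) v₁  ≡⟨ Δ-affine (f x₀) t D v₁ ⟩
    t * Δ G D v₁                   ≡⟨ cong (t *_) (trans (Δ-D v₁) (cong (κ *_) D-v₁)) ⟩
    t * (κ * + 1)                  ≡⟨ cong (t *_) (ℤP.*-identityʳ κ) ⟩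
    t * κ                          ∎)
    where
    open ≡-Reasoning
    x₀ : Fin n
    x₀ = proj₁ (third-element 3≤n v₁ v₂)
    t : ℤ
    t = f v₁ - f x₀
    f-affine : ∀ v → f v ≡ f x₀ + t * D v
    f-affine = affine-in-D f x₀ (proj₂ (third-element 3≤n v₁ v₂))
      (λ x → harmonic-constant conn _ (symmetrisation-harmonic j f Δf≡jD) x x₀)

  D-order : Connected G → 3 ≤ n → ∀ k → κ ≡ + k → 0 < k → HasOrder G D k
  D-order conn 3≤n k κ≡k 0<k = 0<k , κD-principal k κ≡k , not-principal
    where
    not-principal : ∀ j → 0 < j → j < k → ¬ Principal G (j · D)
    not-principal j 0<j j<k jD-principal with principal⇒multiple conn 3≤n j jD-principal
    ... | t , j≡tκ = ℕP.<⇒≱ j<k (∣⇒≤ {{ℕ.>-nonZero 0<j}} (divides ℤ.∣ t ∣ j≡∣t∣k))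
      where
      j≡∣t∣k : j ≡ ℤ.∣ t ∣ ℕ.* k
      j≡∣t∣k = trans (cong ℤ.∣_∣ (trans j≡tκ (cong (t *_) κ≡k))) (ℤP.abs-* t (+ k))

  d-pos : Connected G → 0 < d
  d-pos conn with conn v₁ v₂
  ... | here                = ⊥-elim (v₁≢v₂ refl)
  ... | step {w = w} v₁~w _ = subst (0 <_) deg₁ (deg-pos v₁ w v₁~w)

  κ-adjacent : adj G v₁ v₂ ≡ true → κ ≡ + suc d
  κ-adjacent v₁~v₂ rewrite v₁~v₂ = cong +_ (ℕP.+-comm d 1)

  κ-nonadjacent : adj G v₁ v₂ ≡ false → κ ≡ + d
  κ-nonadjacent v₁≁v₂ rewrite v₁≁v₂ = cong +_ (ℕP.+-identityʳ d)

-- For a pair of vertices, conformity says exactly that they are twins: the condition on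
-- the induced subgraph holds automatically for two vertices.
conformity⇒twins : ∀ {n} (G : Graph n) (v₁ v₂ : Fin n) → v₁ ≢ v₂ → Conformity G (pair v₁ v₂) →
                   ∀ x → x ≢ v₁ → x ≢ v₂ → adj G v₁ x ≡ adj G v₂ x
conformity⇒twins G v₁ v₂ v₁≢v₂ (_ , same-outside) x x≢v₁ x≢v₂ =
  same-outside x v₁ v₂ x-outside v₁-inside v₂-inside
  where
  x-outside : pair v₁ v₂ x ≡ false
  x-outside rewrite ≟-distinct x≢v₁ | ≟-distinct x≢v₂ = refl
  v₁-inside : pair v₁ v₂ v₁ ≡ true
  v₁-inside rewrite ≟-self v₁ = refl
  v₂-inside : pair v₁ v₂ v₂ ≡ true
  v₂-inside rewrite ≟-distinct (v₁≢v₂ ∘ sym) | ≟-self v₂ = refl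

lemma3p1 : (n : ℕ) → 3 ≤ n → (G : Graph n) → Connected G →
    (v₁ v₂ : Fin n) → v₁ ≢ v₂ → (d : ℕ) → deg G v₁ ≡ d → deg G v₂ ≡ d →
    Conformity G (pair v₁ v₂) →
    (adj G v₁ v₂ ≡ true → HasOrder G (diff v₁ v₂) (suc d))
    × (adj G v₁ v₂ ≡ false → HasOrder G (diff v₁ v₂) d)
lemma3p1 n 3≤n G conn v₁ v₂ v₁≢v₂ d deg₁ deg₂ conf =
    (λ v₁~v₂ → D-order conn 3≤n (suc d) (κ-adjacent v₁~v₂) (s≤s z≤n))
  , (λ v₁≁v₂ → D-order conn 3≤n d (κ-nonadjacent v₁≁v₂) (d-pos conn))
  where open Twins G v₁ v₂ v₁≢v₂ (conformity⇒twins G v₁ v₂ v₁≢v₂ conf) d deg₁ deg₂
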